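{- Suppose that $n>50$ and $k\ge 2$. In the Painter-Builder $k$-colouring game on $[n]$, Builder has a strategy ensuring that, after at most $0.2n$ rounds, the game graph $G$ contains a waiting-room $(A,B)$ and $G$ is a union of vertex-disjoint paths of length at most two.
   Context: The Painter-Builder $k$-colouring game on $[n]=\{1,\dots,n\}$ is played between Painter and Builder, alternating turns, Painter first. The game graph $G$ has vertex set $[n]$, initially no edges, all vertices uncoloured. In each round Painter colours one previously uncoloured vertex with one of $k$ colours, then Builder adds an edge between two previously non-adjacent vertices; both must keep the game graph properly coloured. The game ends when all vertices are coloured (Painter wins) or some uncoloured vertex has neighbours of all $k$ colours (Builder wins). A waiting-room $(A,B)$ (at some moment of the game) is a pair of vertex sets $A,B\subseteq [n]$ such that $A$ and $B$ are independent sets in $G$, $|A|=|B|\ge 0.1n/k$, $G[A\cup B]$ is a perfect matching, and all vertices of $A$ are coloured with the same colour. -}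

module Defs where

open import Data.Nat using (ℕ; zero; suc; _*_; _≤_)
open import Data.Fin using (Fin; _≟_)
open import Data.Fin.Subset using (Subset; _∈_; _∪_; ∣_∣)
open import Data.Maybe using (Maybe; just; nothing)
open import Data.List using (List; _∷_; []; length; concat)
import Data.List.Membership.Propositional as LM
open import Data.List.Relation.Unary.All using (All)
open import Data.List.Relation.Unary.Unique.Propositional using (Unique)
open import Data.Product using (Σ; ∃; ∃-syntax; _×_; _,_)
open import Data.Sum using (_⊎_)
open import Data.Empty using (⊥)
open import Relation.Nullary using (¬_; yes; no)
open import Relation.Binary.PropositionalEquality using (_≡_; _≢_)
open import Function.Bundles using (_⇔_)

-- A position of the game on [n] = Fin n with k colours:
-- a partial colouring (nothing = uncoloured) and the list of edges added so far.
record State (n k : ℕ) : Set where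
  constructor state
  field
    col   : Fin n → Maybe (Fin k)
    edges : List (Fin n × Fin n)
open State public

module _ {n k : ℕ} where

  initial : State n k
  initial = state (λ _ → nothing) []

  Adj : State n k → Fin n → Fin n → Set
  Adj s u v = (u , v) LM.∈ edges s ⊎ (v , u) LM.∈ edges s

  PainterLegal : State n k → Fin n → Fin k → Set
  PainterLegal s v c = (col s v ≡ nothing) × (∀ w → Adj s v w → col s w ≢ just c)

  paint : State n k → Fin n → Fin k → State n k
  paint s v c = state newcol (edges s)
    where
    newcol : Fin n → Maybe (Fin k)
    newcol w with w ≟ v
    ... | yes _ = just c
    ... | no _  = col s w

  BuilderLegal : State n k → Fin n → Fin n → Set
  BuilderLegal s u v = (u ≢ v) × ¬ Adj s u v × (∀ c → col s u ≡ just c → col s v ≢ just c)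

  addEdge : State n k → Fin n → Fin n → State n k
  addEdge s u v = state (col s) ((u , v) ∷ edges s)

  -- the game has ended: all vertices coloured (Painter wins), or some
  -- uncoloured vertex has neighbours of all k colours (Builder wins)
  AllColoured : State n k → Set
  AllColoured s = ∀ v → ∃[ c ] col s v ≡ just c

  Blocked : State n k → Fin n → Set
  Blocked s v = (col s v ≡ nothing) × (∀ (c : Fin k) → ∃[ w ] (Adj s v w × col s w ≡ just c))

  Over : State n k → Set
  Over s = AllColoured s ⊎ (∃[ v ] Blocked s v)

  Independent : State n k → Subset n → Set
  Independent s X = ∀ u v → u ∈ X → v ∈ X → ¬ Adj s u v

  PerfectMatchingOn : State n k → Subset n → Set
  PerfectMatchingOn s X =
    ∀ v → v ∈ X → ∃[ w ] (w ∈ X × Adj s v w × (∀ w′ → w′ ∈ X → Adj s v w′ → w′ ≡ w))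

  -- waiting-room (A,B); |A| = |B| ≥ 0.1 n / k  is written  n ≤ 10 * k * |A|
  WaitingRoom : State n k → Subset n → Subset n → Set
  WaitingRoom s A B =
    Independent s A × Independent s B ×
    (∣ A ∣ ≡ ∣ B ∣) × (n ≤ 10 * k * ∣ A ∣) ×
    PerfectMatchingOn s (A ∪ B) ×
    (∃[ c ] (∀ a → a ∈ A → col s a ≡ just c))

  data Consec : List (Fin n) → Fin n → Fin n → Set where
    here  : ∀ {u v xs} → Consec (u ∷ v ∷ xs) u v
    there : ∀ {x xs u v} → Consec xs u v → Consec (x ∷ xs) u v

  -- G is a union of vertex-disjoint paths of length at most two:
  -- a family of paths (vertex sequences with 1 to 3 vertices, i.e. 0 to 2 edges),
  -- pairwise vertex-disjoint and with no repeated vertices, whose edges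
  -- (consecutive pairs) are exactly the edges of G
  PathUnion : State n k → Set
  PathUnion s = Σ (List (List (Fin n))) λ P →
    All (λ p → 1 ≤ length p × length p ≤ 3) P ×
    Unique (concat P) ×
    (∀ u v → Adj s u v ⇔ (∃[ p ] (p LM.∈ P × (Consec p u v ⊎ Consec p v u))))

  Goal : State n k → Set
  Goal s = (∃[ A ] ∃[ B ] WaitingRoom s A B) × PathUnion s

  -- Builder can force the Goal within r (further) rounds from position s.
  -- The game must not have ended before the Goal is reached.
  Force : ℕ → State n k → Set
  Force zero s = Goal s
  Force (suc r) s = Goal s ⊎
    (¬ Over s × (∀ v c → PainterLegal s v c →
       Goal (paint s v c) ⊎
       (¬ Over (paint s v c) ×
        ∃[ u ] ∃[ w ] (BuilderLegal (paint s v c) u w × Force r (addEdge (paint s v c) u w)))))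

-- Builder keeps the game graph a matching in which every coloured vertex is matched: when
-- Painter colours an unmatched vertex v, Builder joins v to a fresh vertex, otherwise he joins
-- two fresh vertices. After t rounds exactly t vertices are coloured and 2t are matched, so
-- fresh vertices exist as long as 2t + 2 ≤ n. For a colour c let A be the vertices of colour c
-- and B the vertices whose partner has colour c. Extending the matching by the identity gives an
-- involution of [n] mapping B onto A, so |A| = |B|; properness makes A and B independent, and
-- A ∪ B is covered by matching edges. After n/5 rounds the most frequent colour c has
-- k |A| ≥ ⌊n/5⌋ ≥ n/10.

module Submission where

open import Defs
open import Data.Nat using (ℕ; _<_; _≤_; zero; suc; _+_; _*_; z≤n; s≤s; z<s; _≤?_)
open import Data.Nat.DivMod using (_/_; _%_; m/n*n≤m; m%n<n; m≡m%n+[m/n]*n; /-monoˡ-≤)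

open import Data.Bool using (Bool; true; false; if_then_else_)
open import Data.Empty using (⊥; ⊥-elim)
open import Data.Fin using (Fin; zero; suc; _≟_; punchIn)
open import Data.Fin.Permutation using (permutation)
open import Data.Fin.Properties using (pigeonhole; ¬∀⟶∃¬; punchInᵢ≢i; <⇒≢)
open import Data.Fin.Subset using (Subset; _∪_; ∣_∣) renaming (_∈_ to _∈ₛ_)
open import Data.Fin.Subset.Properties using (x∈p∪q⁻; x∈p∪q⁺)
open import Data.List using (List; []; _∷_; length; map; concat; lookup)
open import Data.List.Membership.Propositional using (_∈_; _∉_)
open import Data.List.Membership.Propositional.Properties using (∈-map⁺; ∈-map⁻)
open import Data.List.Relation.Unary.All using (All; []; _∷_)
open import Data.List.Relation.Unary.All.Properties using (All¬⇒¬Any; ¬Any⇒All¬)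
open import Data.List.Relation.Unary.AllPairs using ([]; _∷_)
open import Data.List.Relation.Unary.Any using (here; there; index; any?)
open import Data.List.Relation.Unary.Any.Properties using (lookup-index)
open import Data.List.Relation.Unary.Unique.Propositional using (Unique)
open import Data.Maybe using (Maybe; just; nothing)
open import Data.Maybe.Properties using (just-injective) renaming (≡-dec to ≡-dec-Maybe)
open import Data.Nat.Properties
  using ( ≤-refl; ≤-trans; <⇒≤; ≰⇒>; n≤1+n; m≤m+n; m<m+n; +-suc; +-identityʳ; *-comm; *-assoc
        ; *-distribˡ-+; +-mono-≤; +-monoˡ-≤; +-monoʳ-≤; *-monoˡ-≤; *-monoʳ-≤; +-0-commutativeMonoid
        ; module ≤-Reasoning)
open import Algebra.Properties.CommutativeMonoid.Sum +-0-commutativeMonoid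
  using (sum; sum-remove; sum-permute; sum-cong-≗; sum-replicate-zero)
open import Data.Product using (∃-syntax; _×_; _,_; proj₁; proj₂)
open import Data.Sum using (_⊎_; inj₁; inj₂) renaming (swap to ⊎-swap)
import Data.Vec as Vec
open import Data.Vec.Functional using (removeAt)
open import Data.Vec.Properties using (lookup∘tabulate; lookup⇒[]=; []=⇒lookup; tabulate-cong)
open import Function.Base using (_∘_)
open import Function.Bundles using (mk⇔)
open import Relation.Binary.PropositionalEquality
open import Relation.Nullary using (¬_; Dec; yes; no; does)
open import Relation.Nullary.Decidable using (dec-true; dec-false)

indicator : Bool → ℕ
indicator b = if b then 1 else 0

∣tabulate∣≡sum : ∀ {n} (f : Fin n → Bool) → ∣ Vec.tabulate f ∣ ≡ sum (indicator ∘ f)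
∣tabulate∣≡sum {zero}  f = refl
∣tabulate∣≡sum {suc n} f = cons (f zero) {Vec.tabulate (f ∘ suc)} (∣tabulate∣≡sum (f ∘ suc))
  where
  cons : ∀ b {p : Subset n} {m} → ∣ p ∣ ≡ m → ∣ b Vec.∷ p ∣ ≡ indicator b + m
  cons true  eq = cong suc eq
  cons false eq = eq

∈-tabulate⁺ : ∀ {n} {f : Fin n → Bool} {i} → f i ≡ true → i ∈ₛ Vec.tabulate f
∈-tabulate⁺ {f = f} {i} fi = lookup⇒[]= i _ (trans (lookup∘tabulate f i) fi)

∈-tabulate⁻ : ∀ {n} {f : Fin n → Bool} {i} → i ∈ₛ Vec.tabulate f → f i ≡ true
∈-tabulate⁻ {f = f} {i} i∈ = trans (sym (lookup∘tabulate f i)) ([]=⇒lookup i∈)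

sum-suc-at : ∀ {n} (f g : Fin n → ℕ) i → g i ≡ suc (f i) → (∀ j → j ≢ i → g j ≡ f j) →
             sum g ≡ suc (sum f)
sum-suc-at {suc n} f g i gi≡ g≡f = begin
  sum g                           ≡⟨ sum-remove {i = i} g ⟩
  g i + sum (removeAt g i)        ≡⟨ cong₂ _+_ gi≡ (sum-cong-≗ (λ j → g≡f (punchIn i j) (punchInᵢ≢i i j))) ⟩
  suc (f i + sum (removeAt f i))  ≡⟨ cong suc (sum-remove {i = i} f) ⟨
  suc (sum f)                     ∎
  where open ≡-Reasoning

∣tabulate∣-suc-at : ∀ {n} (f g : Fin n → Bool) i → f i ≡ false → g i ≡ true →
                    (∀ j → j ≢ i → g j ≡ f j) → ∣ Vec.tabulate g ∣ ≡ suc ∣ Vec.tabulate f ∣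
∣tabulate∣-suc-at f g i fi gi g≡f = begin
  ∣ Vec.tabulate g ∣      ≡⟨ ∣tabulate∣≡sum g ⟩
  sum (indicator ∘ g)     ≡⟨ sum-suc-at (indicator ∘ f) (indicator ∘ g) i
                               (trans (cong indicator gi) (cong (suc ∘ indicator) (sym fi)))
                               (λ j j≢i → cong indicator (g≡f j j≢i)) ⟩
  suc (sum (indicator ∘ f)) ≡⟨ cong suc (∣tabulate∣≡sum f) ⟨
  suc ∣ Vec.tabulate f ∣  ∎
  where open ≡-Reasoning

∣tabulate∘involution∣ : ∀ {n} (f : Fin n → Bool) (σ : Fin n → Fin n) → (∀ i → σ (σ i) ≡ i) →
                        ∣ Vec.tabulate (f ∘ σ) ∣ ≡ ∣ Vec.tabulate f ∣
∣tabulate∘involution∣ f σ σ∘σ≡id = begin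
  ∣ Vec.tabulate (f ∘ σ) ∣  ≡⟨ ∣tabulate∣≡sum (f ∘ σ) ⟩
  sum (indicator ∘ f ∘ σ)   ≡⟨ sum-permute (indicator ∘ f) (permutation σ σ σ∘σ≡id σ∘σ≡id) ⟨
  sum (indicator ∘ f)       ≡⟨ ∣tabulate∣≡sum f ⟨
  ∣ Vec.tabulate f ∣        ∎
  where open ≡-Reasoning

sum≤*-at : ∀ {m} (f : Fin m → ℕ) → Fin m → ∃[ i ] sum f ≤ m * f i
sum≤*-at {suc zero}    f _ = zero , ≤-refl
sum≤*-at {suc (suc m)} f _ with sum≤*-at (f ∘ suc) zero
... | i , ≤f[1+i] with f zero ≤? f (suc i)
...   | yes f0≤ = suc i , +-mono-≤ f0≤ ≤f[1+i]
...   | no  f0≰ = zero , +-monoʳ-≤ (f zero) (≤-trans ≤f[1+i] (*-monoʳ-≤ (suc m) (<⇒≤ (≰⇒> f0≰))))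

_∈?_ : ∀ {n} (x : Fin n) xs → Dec (x ∈ xs)
x ∈? xs = any? (x ≟_) xs

∃∉ : ∀ {n} (xs : List (Fin n)) → length xs < n → ∃[ x ] x ∉ xs
∃∉ {n} xs |xs|<n = ¬∀⟶∃¬ n (_∈ xs) (_∈? xs) ¬all∈
  where
  ¬all∈ : ¬ (∀ x → x ∈ xs)
  ¬all∈ all∈ with pigeonhole |xs|<n (index ∘ all∈)
  ... | i , j , i<j , same = <⇒≢ i<j (begin
    i                      ≡⟨ lookup-index (all∈ i) ⟩
    lookup xs (index (all∈ i)) ≡⟨ cong (lookup xs) same ⟩
    lookup xs (index (all∈ j)) ≡⟨ lookup-index (all∈ j) ⟨
    j                      ∎)
    where open ≡-Reasoning

cover-by-fresh : ∀ {n} (v : Fin n) (L : List (Fin n)) → ∃[ x ] x ∉ L → ∃[ u ] (u ∉ L × v ∈ u ∷ L)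
cover-by-fresh v L (x , x∉) with v ∈? L
... | yes v∈ = x , x∉ , there v∈
... | no  v∉ = v , v∉ , here refl

[n/5]+[n/5]≤n : ∀ n → n / 5 + n / 5 ≤ n
[n/5]+[n/5]≤n n = begin
  T + T      ≤⟨ +-monoʳ-≤ T (m≤m+n T _) ⟩
  5 * T      ≡⟨ *-comm 5 T ⟩
  T * 5      ≤⟨ m/n*n≤m n 5 ⟩
  n          ∎
  where
  open ≤-Reasoning
  T = n / 5

n≤10*[n/5] : ∀ n → 5 ≤ n → n ≤ 10 * (n / 5)
n≤10*[n/5] n 5≤n = begin
  n              ≡⟨ m≡m%n+[m/n]*n n 5 ⟩
  n % 5 + T * 5  ≤⟨ +-monoˡ-≤ (T * 5) (≤-trans (<⇒≤ (m%n<n n 5)) (*-monoˡ-≤ 5 (/-monoˡ-≤ 5 5≤n))) ⟩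
  T * 5 + T * 5  ≡⟨ *-distribˡ-+ T 5 5 ⟨
  T * 10         ≡⟨ *-comm T 10 ⟩
  10 * T         ∎
  where
  open ≤-Reasoning
  T = n / 5

module _ {n : ℕ} where

  Edges : Set
  Edges = List (Fin n × Fin n)

  ends : Edges → List (Fin n)
  ends []             = []
  ends ((a , b) ∷ es) = a ∷ b ∷ ends es

  Matching : Edges → Set
  Matching es = Unique (ends es)

  Joined : Edges → Fin n → Fin n → Set
  Joined es u w = (u , w) ∈ es ⊎ (w , u) ∈ es

  -- The identity off the matched vertices, so that on a matching it is an involution of Fin n.
  mate : Edges → Fin n → Fin n
  mate []             u = u
  mate ((a , b) ∷ es) u with u ≟ a | u ≟ b
  ... | yes _ | _     = b
  ... | no _  | yes _ = a
  ... | no _  | no _  = mate es u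

  mate-head : ∀ a b es → mate ((a , b) ∷ es) a ≡ b
  mate-head a b es with a ≟ a
  ... | yes _   = refl
  ... | no a≢a = ⊥-elim (a≢a refl)

  mate-head′ : ∀ {a b} es → a ≢ b → mate ((a , b) ∷ es) b ≡ a
  mate-head′ {a} {b} es a≢b with b ≟ a | b ≟ b
  ... | yes b≡a | _       = ⊥-elim (a≢b (sym b≡a))
  ... | no _    | yes _   = refl
  ... | no _    | no b≢b = ⊥-elim (b≢b refl)

  mate-tail : ∀ {a b u} es → u ≢ a → u ≢ b → mate ((a , b) ∷ es) u ≡ mate es u
  mate-tail {a} {b} {u} es u≢a u≢b with u ≟ a | u ≟ b
  ... | yes u≡a | _       = ⊥-elim (u≢a u≡a)
  ... | no _    | yes u≡b = ⊥-elim (u≢b u≡b)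
  ... | no _    | no _    = refl

  matching-head : ∀ {a b es} → Matching ((a , b) ∷ es) → a ≢ b × a ∉ ends es × b ∉ ends es
  matching-head ((a≢b ∷ a∉) ∷ b∉ ∷ _) = a≢b , All¬⇒¬Any a∉ , All¬⇒¬Any b∉

  matching-tail : ∀ {e es} → Matching (e ∷ es) → Matching es
  matching-tail (_ ∷ _ ∷ M) = M

  matching-cons : ∀ {a b es} → a ≢ b → a ∉ ends es → b ∉ ends es → Matching es →
                  Matching ((a , b) ∷ es)
  matching-cons a≢b a∉ b∉ M = (a≢b ∷ ¬Any⇒All¬ _ a∉) ∷ ¬Any⇒All¬ _ b∉ ∷ M

  ∉-ends-cons : ∀ {a b es u} → u ∉ a ∷ b ∷ ends es → u ≢ a × u ≢ b × u ∉ ends es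
  ∉-ends-cons u∉ = u∉ ∘ here , (λ u≡b → u∉ (there (here u≡b))) , (λ u∈ → u∉ (there (there u∈)))

  Joined⇒∈ends : ∀ es {u w} → Joined es u w → u ∈ ends es
  Joined⇒∈ends ((a , b) ∷ es) (inj₁ (here refl)) = here refl
  Joined⇒∈ends ((a , b) ∷ es) (inj₂ (here refl)) = there (here refl)
  Joined⇒∈ends ((a , b) ∷ es) (inj₁ (there uw∈)) = there (there (Joined⇒∈ends es (inj₁ uw∈)))
  Joined⇒∈ends ((a , b) ∷ es) (inj₂ (there wu∈)) = there (there (Joined⇒∈ends es (inj₂ wu∈)))

  mate-∉ : ∀ es {u} → u ∉ ends es → mate es u ≡ u
  mate-∉ []             u∉ = refl
  mate-∉ ((a , b) ∷ es) u∉ with ∉-ends-cons u∉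
  ... | u≢a , u≢b , u∉es = trans (mate-tail es u≢a u≢b) (mate-∉ es u∉es)

  mate-Joined : ∀ es {u} → u ∈ ends es → Joined es u (mate es u)
  mate-Joined ((a , b) ∷ es) {u} u∈ with u ≟ a | u ≟ b | u∈
  ... | yes refl | _        | _               = inj₁ (here refl)
  ... | no _     | yes refl | _               = inj₂ (here refl)
  ... | no u≢a   | no _     | here u≡a        = ⊥-elim (u≢a u≡a)
  ... | no _     | no u≢b   | there (here u≡b) = ⊥-elim (u≢b u≡b)
  ... | no _     | no _     | there (there u∈es) with mate-Joined es u∈es
  ...   | inj₁ p = inj₁ (there p)
  ...   | inj₂ p = inj₂ (there p)

  mate-skip-head : ∀ {a b es u w} → Matching ((a , b) ∷ es) → Joined es u w →
                   mate es u ≡ w → mate ((a , b) ∷ es) u ≡ w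
  mate-skip-head {es = es} M uw eq with matching-head M | Joined⇒∈ends es uw
  ... | _ , a∉ , b∉ | u∈es = trans (mate-tail es (λ { refl → a∉ u∈es }) (λ { refl → b∉ u∈es })) eq

  Joined⇒mate : ∀ es {u w} → Matching es → Joined es u w → mate es u ≡ w
  Joined⇒mate ((a , b) ∷ es) M (inj₁ (here refl)) = mate-head a b es
  Joined⇒mate ((a , b) ∷ es) M (inj₂ (here refl)) = mate-head′ es (proj₁ (matching-head M))
  Joined⇒mate ((a , b) ∷ es) M (inj₁ (there uw)) =
    mate-skip-head M (inj₁ uw) (Joined⇒mate es (matching-tail M) (inj₁ uw))
  Joined⇒mate ((a , b) ∷ es) M (inj₂ (there wu)) =
    mate-skip-head M (inj₂ wu) (Joined⇒mate es (matching-tail M) (inj₂ wu))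

  Joined-sym : ∀ {es u w} → Joined es u w → Joined es w u
  Joined-sym = ⊎-swap

  mate-involutive : ∀ es → Matching es → ∀ u → mate es (mate es u) ≡ u
  mate-involutive es M u with u ∈? ends es
  ... | yes u∈ = Joined⇒mate es M (Joined-sym (mate-Joined es u∈))
  ... | no  u∉ = trans (cong (mate es) (mate-∉ es u∉)) (mate-∉ es u∉)

  Joined-functional : ∀ es {u w w′} → Matching es → Joined es u w → Joined es u w′ → w ≡ w′
  Joined-functional es M uw uw′ = trans (sym (Joined⇒mate es M uw)) (Joined⇒mate es M uw′)

  Joined-irrefl : ∀ es {u} → Matching es → ¬ Joined es u u
  Joined-irrefl ((a , b) ∷ es) M (inj₁ (here refl)) = proj₁ (matching-head M) refl
  Joined-irrefl ((a , b) ∷ es) M (inj₂ (here refl)) = proj₁ (matching-head M) refl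
  Joined-irrefl ((a , b) ∷ es) M (inj₁ (there uu)) = Joined-irrefl es (matching-tail M) (inj₁ uu)
  Joined-irrefl ((a , b) ∷ es) M (inj₂ (there uu)) = Joined-irrefl es (matching-tail M) (inj₂ uu)

module _ {n k : ℕ} where

  isColour : Maybe (Fin k) → Fin k → Bool
  isColour m c = does (≡-dec-Maybe _≟_ m (just c))

  isColour-just : ∀ {m c} → m ≡ just c → isColour m c ≡ true
  isColour-just {m} {c} = dec-true (≡-dec-Maybe _≟_ m (just c))

  isColour-≢ : ∀ {m c} → m ≢ just c → isColour m c ≡ false
  isColour-≢ {m} {c} = dec-false (≡-dec-Maybe _≟_ m (just c))

  preimage : (Fin n → Maybe (Fin k)) → Fin k → Subset n
  preimage f c = Vec.tabulate (λ u → isColour (f u) c)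

  ∈-preimage⁺ : ∀ f {u c} → f u ≡ just c → u ∈ₛ preimage f c
  ∈-preimage⁺ f fu≡ = ∈-tabulate⁺ (isColour-just fu≡)

  ∈-preimage⁻ : ∀ f {u c} → u ∈ₛ preimage f c → f u ≡ just c
  ∈-preimage⁻ f {u} {c} u∈ with ≡-dec-Maybe _≟_ (f u) (just c) | ∈-tabulate⁻ {f = λ u → isColour (f u) c} u∈
  ... | yes fu≡ | _ = fu≡

  colourClass : State n k → Fin k → Subset n
  colourClass s = preimage (col s)

  ProperlyColoured : State n k → Set
  ProperlyColoured s = ∀ {u w c} → Adj s u w → col s u ≡ just c → col s w ≢ just c

  paint-≡ : ∀ (s : State n k) v c → col (paint s v c) v ≡ just c
  paint-≡ s v c with v ≟ v
  ... | yes _   = refl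
  ... | no v≢v = ⊥-elim (v≢v refl)

  paint-≢ : ∀ (s : State n k) {v w} c → w ≢ v → col (paint s v c) w ≡ col s w
  paint-≢ s {v} {w} c w≢v with w ≟ v
  ... | yes w≡v = ⊥-elim (w≢v w≡v)
  ... | no _    = refl

  ∣colourClass-paint∣ : ∀ (s : State n k) {v} c → col s v ≡ nothing →
                        ∣ colourClass (paint s v c) c ∣ ≡ suc ∣ colourClass s c ∣
  ∣colourClass-paint∣ s {v} c v-blank = ∣tabulate∣-suc-at _ _ v
    (cong (λ m → isColour m c) v-blank)
    (isColour-just (paint-≡ s v c))
    (λ w w≢v → cong (λ m → isColour m c) (paint-≢ s c w≢v))

  colourClass-paint-≢ : ∀ (s : State n k) {v c d} → col s v ≡ nothing → d ≢ c →
                        colourClass (paint s v c) d ≡ colourClass s d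
  colourClass-paint-≢ s {v} {c} {d} v-blank d≢c = tabulate-cong same
    where
    same : ∀ w → isColour (col (paint s v c) w) d ≡ isColour (col s w) d
    same w with w ≟ v
    ... | yes refl = trans (isColour-≢ (d≢c ∘ sym ∘ just-injective)) (cong (λ m → isColour m d) (sym v-blank))
    ... | no _     = refl

  sum-colourClass-paint : ∀ (s : State n k) {v} c → col s v ≡ nothing →
                          sum (∣_∣ ∘ colourClass (paint s v c)) ≡ suc (sum (∣_∣ ∘ colourClass s))
  sum-colourClass-paint s c v-blank = sum-suc-at _ _ c (∣colourClass-paint∣ s c v-blank)
    (λ d d≢c → cong ∣_∣ (colourClass-paint-≢ s v-blank d≢c))

  proper-paint : ∀ {s : State n k} {v c} → Matching (edges s) → PainterLegal s v c →
                 ProperlyColoured s → ProperlyColoured (paint s v c)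
  proper-paint {s} {v} {c} M (_ , legal) proper {u} {w} {d} uw cu cw = cases (u ≟ v) (w ≟ v)
    where
    d≡c : col (paint s v c) v ≡ just d → d ≡ c
    d≡c cv = just-injective (trans (sym cv) (paint-≡ s v c))
    old : ∀ {x} → x ≢ v → col (paint s v c) x ≡ just d → col s x ≡ just d
    old x≢v = trans (sym (paint-≢ s c x≢v))
    cases : Dec (u ≡ v) → Dec (w ≡ v) → ⊥
    cases (yes refl) (yes refl) = Joined-irrefl (edges s) M uw
    cases (yes refl) (no w≢v)   = legal w uw (subst (λ e → col s w ≡ just e) (d≡c cu) (old w≢v cw))
    cases (no u≢v)   (yes refl) =
      legal u (Joined-sym uw) (subst (λ e → col s u ≡ just e) (d≡c cw) (old u≢v cu))
    cases (no u≢v)   (no w≢v)   = proper uw (old u≢v cu) (old w≢v cw)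

  record Invariant (s : State n k) (t : ℕ) : Set where
    field
      matching         : Matching (edges s)
      length-ends      : length (ends (edges s)) ≡ t + t
      coloured⇒matched : ∀ {u c} → col s u ≡ just c → u ∈ ends (edges s)
      proper           : ProperlyColoured s
      sum-colourClass  : sum (∣_∣ ∘ colourClass s) ≡ t

  invariant-initial : Invariant initial 0
  invariant-initial = record
    { matching         = []
    ; length-ends      = refl
    ; coloured⇒matched = λ ()
    ; proper           = λ { (inj₁ ()) ; (inj₂ ()) }
    ; sum-colourClass  = trans (sum-cong-≗ {k} ∣colourClass∣≡0) (sum-replicate-zero k)
    }
    where
    ∣colourClass∣≡0 : ∀ c → ∣ colourClass initial c ∣ ≡ 0
    ∣colourClass∣≡0 c = trans (∣tabulate∣≡sum {n} (λ _ → false)) (sum-replicate-zero n)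

  unmatched⇒uncoloured : ∀ {s t x} → Invariant s t → x ∉ ends (edges s) → col s x ≡ nothing
  unmatched⇒uncoloured {s} {x = x} I x∉ with col s x in cx
  ... | nothing = refl
  ... | just c  = ⊥-elim (x∉ (Invariant.coloured⇒matched I cx))

  unmatched⇒uncoloured-paint : ∀ {s t x v c} → Invariant s t → x ∉ ends (edges s) → x ≢ v →
                               col (paint s v c) x ≡ nothing
  unmatched⇒uncoloured-paint {s} {c = c} I x∉ x≢v =
    trans (paint-≢ s c x≢v) (unmatched⇒uncoloured I x∉)

  round : ∀ {s t v c u y} → Invariant s t → PainterLegal s v c →
          u ∉ ends (edges s) → y ∉ u ∷ ends (edges s) → v ∈ u ∷ ends (edges s) →
          BuilderLegal (paint s v c) u y × Invariant (addEdge (paint s v c) u y) (suc t)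
  round {s} {t} {v} {c} {u} {y} I legal@(v-blank , _) u∉ y∉ v∈ =
    (u≢y , u∉ ∘ Joined⇒∈ends (edges s) , λ _ _ → nothing≢just ∘ trans (sym y-blank)) , record
      { matching         = matching-cons u≢y u∉ y∉ends matching
      ; length-ends      = cong suc (trans (cong suc length-ends) (sym (+-suc t t)))
      ; coloured⇒matched = coloured⇒matched′
      ; proper           = proper′
      ; sum-colourClass  = trans (sum-colourClass-paint s c v-blank) (cong suc sum-colourClass)
      }
    where
    open Invariant I
    u≢y : u ≢ y
    u≢y u≡y = y∉ (here (sym u≡y))
    y∉ends : y ∉ ends (edges s)
    y∉ends y∈ = y∉ (there y∈)
    y-blank : col (paint s v c) y ≡ nothing
    y-blank = unmatched⇒uncoloured-paint I y∉ends (λ { refl → y∉ v∈ })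
    nothing≢just : ∀ {d : Fin k} → nothing ≢ just d
    nothing≢just ()
    coloured⇒matched′ : ∀ {w d} → col (paint s v c) w ≡ just d → w ∈ u ∷ y ∷ ends (edges s)
    coloured⇒matched′ {w} cw with w ≟ v
    ... | yes refl = weaken v∈
      where
      weaken : ∀ {L} → w ∈ u ∷ L → w ∈ u ∷ y ∷ L
      weaken (here w≡u)  = here w≡u
      weaken (there w∈L) = there (there w∈L)
    ... | no w≢v   = there (there (coloured⇒matched cw))
    proper′ : ProperlyColoured (addEdge (paint s v c) u y)
    proper′ (inj₁ (here refl)) _ = nothing≢just ∘ trans (sym y-blank)
    proper′ (inj₂ (here refl)) cy = ⊥-elim (nothing≢just (trans (sym y-blank) cy))
    proper′ (inj₁ (there ab))  = proper-paint matching legal proper (inj₁ ab)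
    proper′ (inj₂ (there ba))  = proper-paint matching legal proper (inj₂ ba)

  ¬Over : ∀ {s : State n k} {x c₀ c₁} → c₀ ≢ c₁ → Matching (edges s) → col s x ≡ nothing → ¬ Over s
  ¬Over {x = x} _ _ x-blank (inj₁ all-coloured) with all-coloured x
  ... | _ , x-coloured with trans (sym x-blank) x-coloured
  ...   | ()
  ¬Over {s} {c₀ = c₀} {c₁} c₀≢c₁ M _ (inj₂ (v , _ , sees)) with sees c₀ | sees c₁
  ... | w₀ , vw₀ , cw₀ | w₁ , vw₁ , cw₁ = c₀≢c₁ (just-injective (begin
    just c₀       ≡⟨ cw₀ ⟨
    col s w₀      ≡⟨ cong (col s) (Joined-functional (edges s) M vw₀ vw₁) ⟩
    col s w₁      ≡⟨ cw₁ ⟩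
    just c₁       ∎))
    where open ≡-Reasoning

  edgePath : Fin n × Fin n → List (Fin n)
  edgePath (a , b) = a ∷ b ∷ []

  pathUnion : ∀ {s : State n k} → Matching (edges s) → PathUnion s
  pathUnion {s} M = map edgePath (edges s) , short (edges s) ,
      subst Unique (sym (concat-edgePaths (edges s))) M , λ u w → mk⇔ (to u w) (from u w)
    where
    short : ∀ es → All (λ p → 1 ≤ length p × length p ≤ 3) (map edgePath es)
    short []       = []
    short (_ ∷ es) = (s≤s z≤n , s≤s (s≤s z≤n)) ∷ short es
    concat-edgePaths : ∀ es → concat (map edgePath es) ≡ ends es
    concat-edgePaths []             = refl
    concat-edgePaths ((a , b) ∷ es) = cong (λ l → a ∷ b ∷ l) (concat-edgePaths es)
    OnPath : Fin n → Fin n → Set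
    OnPath u w = ∃[ p ] (p ∈ map edgePath (edges s) × (Consec p u w ⊎ Consec p w u))
    to : ∀ u w → Adj s u w → OnPath u w
    to u w (inj₁ uw∈) = edgePath (u , w) , ∈-map⁺ edgePath uw∈ , inj₁ here
    to u w (inj₂ wu∈) = edgePath (w , u) , ∈-map⁺ edgePath wu∈ , inj₂ here
    from : ∀ u w → OnPath u w → Adj s u w
    from u w (p , p∈ , consec) with ∈-map⁻ edgePath p∈
    ... | _ , e∈ , refl with consec
    ...   | inj₁ here                 = inj₁ e∈
    ...   | inj₂ here                 = inj₂ e∈
    ...   | inj₁ (there (there ()))
    ...   | inj₂ (there (there ()))

  waitingRoom : ∀ {s : State n k} {t} → Fin k → Invariant s t → n ≤ 10 * t →
                ∃[ A ] ∃[ B ] WaitingRoom s A B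
  waitingRoom {s} {t} c₀ I n≤10t =
    A , B , independent-A , independent-B , sym ∣B∣≡∣A∣ , n≤10k∣A∣ , perfectMatching , c , λ _ → colour-A
    where
    open Invariant I
    es = edges s
    σ  = mate es
    largest = sum≤*-at (∣_∣ ∘ colourClass s) c₀
    c  = proj₁ largest
    A  = colourClass s c
    B  = preimage (col s ∘ σ) c

    colour-A : ∀ {u} → u ∈ₛ A → col s u ≡ just c
    colour-A = ∈-preimage⁻ (col s)

    colour-B : ∀ {u} → u ∈ₛ B → col s (σ u) ≡ just c
    colour-B = ∈-preimage⁻ (col s ∘ σ)

    independent-A : Independent s A
    independent-A u w u∈ w∈ uw = proper uw (colour-A u∈) (colour-A w∈)

    independent-B : Independent s B
    independent-B u w u∈ w∈ uw = proper uw
      (subst (λ x → col s x ≡ just c) (Joined⇒mate es matching (Joined-sym uw)) (colour-B w∈))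
      (subst (λ x → col s x ≡ just c) (Joined⇒mate es matching uw) (colour-B u∈))

    ∣B∣≡∣A∣ : ∣ B ∣ ≡ ∣ A ∣
    ∣B∣≡∣A∣ = ∣tabulate∘involution∣ (λ u → isColour (col s u) c) σ (mate-involutive es matching)

    n≤10k∣A∣ : n ≤ 10 * k * ∣ A ∣
    n≤10k∣A∣ = begin
      n                              ≤⟨ n≤10t ⟩
      10 * t                         ≡⟨ cong (10 *_) sum-colourClass ⟨
      10 * sum (∣_∣ ∘ colourClass s) ≤⟨ *-monoʳ-≤ 10 (proj₂ largest) ⟩
      10 * (k * ∣ A ∣)               ≡⟨ *-assoc 10 k ∣ A ∣ ⟨
      10 * k * ∣ A ∣                 ∎
      where open ≤-Reasoning

    Joined-mate : ∀ {u} → u ∈ₛ A ∪ B → Joined es u (σ u)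
    Joined-mate {u} u∈ with x∈p∪q⁻ A B u∈
    ... | inj₁ u∈A = mate-Joined es (coloured⇒matched (colour-A u∈A))
    ... | inj₂ u∈B = Joined-sym (subst (Joined es (σ u)) (mate-involutive es matching u)
                                       (mate-Joined es (coloured⇒matched (colour-B u∈B))))

    mate∈A∪B : ∀ {u} → u ∈ₛ A ∪ B → σ u ∈ₛ A ∪ B
    mate∈A∪B {u} u∈ with x∈p∪q⁻ A B u∈
    ... | inj₁ u∈A = x∈p∪q⁺ (inj₂ (∈-preimage⁺ (col s ∘ σ)
                                     (trans (cong (col s) (mate-involutive es matching u)) (colour-A u∈A))))
    ... | inj₂ u∈B = x∈p∪q⁺ (inj₁ (∈-preimage⁺ (col s) (colour-B u∈B)))

    perfectMatching : PerfectMatchingOn s (A ∪ B)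
    perfectMatching u u∈ = σ u , mate∈A∪B u∈ , Joined-mate u∈ ,
      λ w _ uw → sym (Joined⇒mate es matching uw)

  force : ∀ {c₀ c₁ : Fin k} → c₀ ≢ c₁ → ∀ {T} r {s : State n k} {t} → Invariant s t →
          T + T ≤ n → n ≤ 10 * T → t + r ≡ T → Force r s
  force {c₀} _ zero {s} {t} I _ n≤10T refl =
    waitingRoom c₀ I (subst (λ m → n ≤ 10 * m) (+-identityʳ t) n≤10T) ,
    pathUnion {s} (Invariant.matching I)
  force c₀≢c₁ (suc r) {s} {t} I T+T≤n n≤10T refl =
    inj₂ (¬Over c₀≢c₁ matching (unmatched⇒uncoloured I (proj₂ fresh)) , respond)
    where
    open Invariant I
    L = ends (edges s)
    room : suc (suc (length L)) ≤ n
    room = begin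
      suc (suc (length L))      ≡⟨ cong (2 +_) length-ends ⟩
      suc (suc (t + t))         ≡⟨ cong suc (+-suc t t) ⟨
      suc t + suc t             ≤⟨ +-mono-≤ (m<m+n t z<s) (m<m+n t z<s) ⟩
      t + suc r + (t + suc r)   ≤⟨ T+T≤n ⟩
      n                         ∎
      where open ≤-Reasoning
    fresh : ∃[ x ] x ∉ L
    fresh = ∃∉ L (≤-trans (n≤1+n _) room)
    respond : ∀ v c → PainterLegal s v c →
              Goal (paint s v c) ⊎
              (¬ Over (paint s v c) × ∃[ u ] ∃[ y ] (BuilderLegal (paint s v c) u y ×
                                                     Force r (addEdge (paint s v c) u y)))
    respond v c legal with cover-by-fresh v L fresh
    ... | u , u∉ , v∈ with ∃∉ (u ∷ L) room
    ...   | y , y∉ = inj₂ (¬Over {x = y} c₀≢c₁ matching y-blank , u , y , proj₁ next ,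
                           force c₀≢c₁ r (proj₂ next) T+T≤n n≤10T (sym (+-suc t r)))
      where
      y-blank : col (paint s v c) y ≡ nothing
      y-blank = unmatched⇒uncoloured-paint I (λ y∈ → y∉ (there y∈)) (λ { refl → y∉ v∈ })
      next = round I legal u∉ y∉ v∈

lemma2 : (n k : ℕ) → 50 < n → 2 ≤ k → Force {n} {k} (n / 5) initial
lemma2 n (suc (suc k)) 50<n (s≤s (s≤s z≤n)) =
  force {c₀ = zero} {c₁ = suc zero} (λ ()) (n / 5) invariant-initial
    ([n/5]+[n/5]≤n n) (n≤10*[n/5] n (≤-trans (m≤m+n 5 46) 50<n)) refl
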